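{- Let $(G,w)$ be a weighted trigraph and let $(A,B,C)$ be a cut-partition of $G$. For each $X\in\{A,B\}$, let $G_X$ be a trigraph obtained from $G[X\cup C]$ by possibly turning some strongly anti-adjacent pairs of $G[X\cup C]$ into semi-adjacent pairs (so $w$ restricted to $D(G_X)$ is a weight function for $G_X$). For all $C'\subseteq C$, set $\alpha_{A\cup C'}=\alpha(\mathrm{Red}[G_A,w;A\cup C'])+\mathrm{Ext}[G_A,w;A\cup C']$. Let $k\in\mathbb{N}$ and let $w_B$ be a weight function for $G_B$ such that: (i) $w_B(u)=w(u)$ for all $u\in B$; (ii) for all $uv\in\binom{B\cup C}{2}\setminus\binom{C}{2}$, $w_B(u,v)=w(u,v)$, $w_B(v,u)=w(v,u)$ and $w_B(uv)=w(uv)$; (iii) for every $S_C\subseteq C$ that is a stable set of $G_B$, $\mathrm{wt}_{(G_B[C],w_B)}(S_C)=\alpha_{A\cup S_C}-k$. Then $\alpha(G,w)=k+\alpha(G_B,w_B)$.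
   Context: A trigraph $G$ consists of a finite set $V(G)$ and a function $\theta_G:\binom{V(G)}{2}\to\{ -1,0,1\}$; for distinct vertices $u,v$ write $uv$ for $\{u,v\}$; it is strongly adjacent if $\theta_G(uv)=1$, semi-adjacent if $\theta_G(uv)=0$, strongly anti-adjacent if $\theta_G(uv)=-1$; $u,v$ are anti-adjacent if $\theta_G(uv)\le 0$. A stable set is a set of pairwise anti-adjacent vertices. $G[X]$ is the trigraph on $X$ with $\theta_G$ restricted. Let $D(G)=V(G)\cup\{(u,v): u,v\in V(G),u\neq v\}\cup\binom{V(G)}{2}$. A weight function for $G$ is a map $w:D(G)\to\mathbb{N}$ such that for all distinct $u,v$: if $uv$ is not semi-adjacent then $w(u,v)=w(v,u)=w(uv)=0$, and $w(u,v)\le w(uv)$. A weighted trigraph is a pair $(G,w)$; for an induced subtrigraph $H$, $(H,w)$ means $w$ restricted to $D(H)$. For $S\subseteq V(G)$, $\mathrm{wt}_{(G,w)}(S)=\sum_{u\in S}w(u)+\sum_{u\in S}\sum_{v\in V(G)\setminus S}w(u,v)+\sum_{uv\in\binom{V(G)\setminus S}{2}}w(uv)$, and $\alpha(G,w)=\max\{\mathrm{wt}_{(G,w)}(S): S\text{ stable in }G\}$. For $R\subseteq V(G)$, $\mathrm{Red}[G,w;R]$ is the weighted trigraph $(G[R],w')$ where $w'(u)=\max\{w(u)-\sum_{v\in V(G)\setminus R}(w(uv)-w(u,v)),0\}$ for $u\in R$, and $w'(u,v)=w(u,v)$, $w'(uv)=w(uv)$ for distinct $u,v\in R$; and $\mathrm{Ext}[G,w;R]=\sum_{uv\in\binom{V(G)\setminus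 R}{2}}w(uv)+\sum_{u\in R}\sum_{v\in V(G)\setminus R}w(uv)$. A cut-partition of $G$ is a partition $(A,B,C)$ of $V(G)$ with $A,B$ non-empty ($C$ possibly empty) such that every vertex of $A$ is strongly anti-adjacent to every vertex of $B$. -}

module Defs where

open import Data.Nat using (ℕ; zero; suc; _+_; _∸_; _⊔_; _≤_)
open import Data.Bool using (Bool; true; false; if_then_else_)
open import Data.Fin using (Fin; zero; suc; toℕ; _<_)
import Data.Fin as F
open import Data.Fin.Properties using (all?)
open import Data.Fin.Subset using (Subset; _∈_; _∉_; _⊆_; _∪_; _─_; Nonempty)
open import Data.Fin.Subset.Properties using (_∈?_; _⊆?_)
open import Data.Vec using (_∷_; [])
open import Data.Product using (_×_; _,_)
open import Data.Sum using (_⊎_)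
open import Relation.Nullary using (¬_; Dec; yes; no; does)
open import Relation.Nullary.Decidable using (_→-dec_; ¬?; _×-dec_)
open import Relation.Binary.PropositionalEquality using (_≡_; _≢_; refl)

-- Adjacency values: strong = θ 1, semi = θ 0, anti = θ -1

data Adj : Set where
  strong semi anti : Adj

-- u,v anti-adjacent iff θ(uv) ≤ 0, i.e. θ(uv) ≠ 1
Anti : Adj → Set
Anti a = a ≢ strong

anti? : (a : Adj) → Dec (Anti a)
anti? strong = no (λ f → f refl)
anti? semi   = yes (λ ())
anti? anti   = yes (λ ())

-- A trigraph with vertex set Fin n.  θ is a symmetric function on
-- ordered pairs (values on the diagonal are irrelevant and never used),
-- encoding θ_G : binom(V(G),2) → {-1,0,1}.
-- Induced subtrigraphs G[X] are represented by the pair (G , X) with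
-- X : Subset n: all notions below take the current vertex set U as a
-- parameter.

record Trigraph (n : ℕ) : Set where
  field
    θ     : Fin n → Fin n → Adj
    θ-sym : ∀ u v → θ u v ≡ θ v u
open Trigraph public

-- Weights: wv u = w(u), wo u v = w(u,v), wu u v = w(uv)
-- (wu is required to be symmetric on the vertex set, see IsWeight).
record Weights (n : ℕ) : Set where
  field
    wv : Fin n → ℕ
    wo : Fin n → Fin n → ℕ
    wu : Fin n → Fin n → ℕ
open Weights public

IsWeight : ∀ {n} → Trigraph n → Subset n → Weights n → Set
IsWeight G U w = ∀ u v → u ∈ U → v ∈ U → u ≢ v →
    (wu w u v ≡ wu w v u)
  × (θ G u v ≢ semi → wo w u v ≡ 0 × wo w v u ≡ 0 × wu w u v ≡ 0)
  × (wo w u v ≤ wu w u v)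

Σ[_] : (n : ℕ) → (Fin n → ℕ) → ℕ
Σ[ zero  ] f = 0
Σ[ suc n ] f = f zero + Σ[ n ] (λ i → f (suc i))

ΣS : ∀ {n} → Subset n → (Fin n → ℕ) → ℕ
ΣS {n} S f = Σ[ n ] (λ i → if does (i ∈? S) then f i else 0)

ΣPairs : ∀ {n} → Subset n → (Fin n → Fin n → ℕ) → ℕ
ΣPairs {n} S g = ΣS S (λ u → ΣS S (λ v → if does (u F.<? v) then g u v else 0))

wt : ∀ {n} → Subset n → Weights n → Subset n → ℕ
wt U w S = ΣS S (wv w)
         + ΣS S (λ u → ΣS (U ─ S) (λ v → wo w u v))
         + ΣPairs (U ─ S) (wu w)

Stable : ∀ {n} → Trigraph n → Subset n → Set
Stable G S = ∀ u v → u ∈ S → v ∈ S → u ≢ v → Anti (θ G u v)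

stable? : ∀ {n} (G : Trigraph n) (S : Subset n) → Dec (Stable G S)
stable? G S = all? (λ u → all? (λ v →
  (u ∈? S) →-dec ((v ∈? S) →-dec (¬? (u F.≟ v) →-dec anti? (θ G u v)))))

maxSub : (n : ℕ) → (Subset n → ℕ) → ℕ
maxSub zero    f = f []
maxSub (suc n) f = maxSub n (λ S → f (false ∷ S)) ⊔ maxSub n (λ S → f (true ∷ S))

-- α(G[U],w) = max { wt(S) : S ⊆ U stable }  (the empty set is stable,
-- and weights are non-negative, so the default 0 does not affect the max)
α : ∀ {n} → Trigraph n → Subset n → Weights n → ℕ
α {n} G U w = maxSub n (λ S →
  if does ((S ⊆? U) ×-dec stable? G S) then wt U w S else 0)

-- Red and Ext, for the weighted trigraph (G[U],w) and R ⊆ U.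
-- Red[G[U],w;R] = (G[R], Red-w U R w)

Red-w : ∀ {n} → Subset n → Subset n → Weights n → Weights n
Red-w U R w = record
  { wv = λ u → wv w u ∸ ΣS (U ─ R) (λ v → wu w u v ∸ wo w u v)
  ; wo = wo w
  ; wu = wu w
  }

αRed : ∀ {n} → Trigraph n → Subset n → Weights n → Subset n → ℕ
αRed G U w R = α G R (Red-w U R w)

Ext : ∀ {n} → Subset n → Weights n → Subset n → ℕ
Ext U w R = ΣPairs (U ─ R) (wu w) + ΣS R (λ u → ΣS (U ─ R) (λ v → wu w u v))

IsPartition : ∀ {n} → Subset n → Subset n → Subset n → Set
IsPartition A B C = ∀ v →
    (v ∈ A ⊎ v ∈ B ⊎ v ∈ C)
  × (v ∈ A → v ∉ B) × (v ∈ A → v ∉ C) × (v ∈ B → v ∉ C)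

IsCutPartition : ∀ {n} → Trigraph n → Subset n → Subset n → Subset n → Set
IsCutPartition G A B C =
  IsPartition A B C × Nonempty A × Nonempty B ×
  (∀ a b → a ∈ A → b ∈ B → θ G a b ≡ anti)

Relaxes : ∀ {n} → Trigraph n → Subset n → Trigraph n → Set
Relaxes G X H = ∀ u v → u ∈ X → v ∈ X → u ≢ v →
  (θ H u v ≡ θ G u v) ⊎ (θ G u v ≡ anti × θ H u v ≡ semi)

module Submission where

-- The weight wt_U(S) of a set S in (G[U],w) is a sum of local
-- contributions: every vertex contributes according to its status with
-- respect to S and U (chosen, free or outside), and every pair u < v
-- according to the statuses of its two ends (wt-local).  Each comparison
-- between weights of sets therefore reduces to a finite case analysis on
-- the statuses of a single vertex or a single pair.
-- The proposition then follows by splitting an optimal stable set of G along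
-- the cut (upper), and by gluing an optimal stable set T of G_B with an
-- optimal A-side completion of T ∩ C (lower).

open import Defs
open import Data.Nat using (ℕ; zero; suc; _+_; _∸_; _≤_; _≤?_; z≤n)
open import Data.Nat.Properties
open import Data.Nat.Tactic.RingSolver using (solve-∀)
open import Algebra.Properties.CommutativeSemigroup +-commutativeSemigroup using (interchange)
open import Data.Bool using (Bool; true; false; if_then_else_; _∧_; _∨_)
open import Data.Fin.Subset using (Subset; _∈_; _∉_; _⊆_; _∩_; _∪_; _─_; ⊤) renaming (⊥ to ∅)
open import Data.Product using (_×_; _,_; proj₁; proj₂; ∃)
open import Data.Sum using (_⊎_; inj₁; inj₂)
open import Data.Unit using (tt) renaming (⊤ to Unit)
open import Data.Empty using (⊥; ⊥-elim)
open import Data.Fin.Subset.Properties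
  using (_∈?_; _⊆?_; ∉⊥; ∈⊤; x∈p∩q⁺; x∈p∩q⁻; x∈p∪q⁺; x∈p∪q⁻; p∩q⊆p; p∩q⊆q; q⊆p∪q; ⊆-antisym;
         ∩-assoc; ∩-comm; ∪-comm; ∩-abs-∪)
open import Data.Vec using ([]; _∷_; lookup; tabulate)
open import Data.Vec.Properties using ([]=⇒lookup; lookup⇒[]=; lookup-zipWith; lookup-replicate; lookup∘tabulate)
open import Data.Fin using (Fin; zero; suc)
import Data.Fin as F
import Data.Fin.Properties as FinP
open import Relation.Nullary using (Dec; does; yes; no; ¬_)
open import Relation.Nullary.Decidable using (dec-true; dec-false; _×-dec_)
open import Relation.Binary.PropositionalEquality

guard : Bool → ℕ → ℕ
guard b x = if b then x else 0

Σ-cong : ∀ {n} {f g : Fin n → ℕ} → (∀ i → f i ≡ g i) → Σ[ n ] f ≡ Σ[ n ] g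
Σ-cong {zero}  h = refl
Σ-cong {suc n} h = cong₂ _+_ (h zero) (Σ-cong (λ i → h (suc i)))

Σ-mono : ∀ {n} {f g : Fin n → ℕ} → (∀ i → f i ≤ g i) → Σ[ n ] f ≤ Σ[ n ] g
Σ-mono {zero}  h = z≤n
Σ-mono {suc n} h = +-mono-≤ (h zero) (Σ-mono (λ i → h (suc i)))

Σ-+ : ∀ {n} (f g : Fin n → ℕ) → Σ[ n ] (λ i → f i + g i) ≡ Σ[ n ] f + Σ[ n ] g
Σ-+ {zero}  f g = refl
Σ-+ {suc n} f g = trans (cong (f zero + g zero +_) (Σ-+ (λ i → f (suc i)) (λ i → g (suc i))))
                        (interchange (f zero) (g zero) _ _)

Σ-zero : ∀ {n} {f : Fin n → ℕ} → (∀ i → f i ≡ 0) → Σ[ n ] f ≡ 0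
Σ-zero {zero}  h = refl
Σ-zero {suc n} h = cong₂ _+_ (h zero) (Σ-zero (λ i → h (suc i)))

ΣΣ : ∀ {n} → (Fin n → Fin n → ℕ) → ℕ
ΣΣ {n} f = Σ[ n ] (λ u → Σ[ n ] (λ v → f u v))

Σ< : ∀ {n} → (Fin n → Fin n → ℕ) → ℕ
Σ< f = ΣΣ (λ u v → guard (does (u F.<? v)) (f u v))

guard-≤ : ∀ {P : Set} (d : Dec P) {x y : ℕ} → (P → x ≤ y) → guard (does d) x ≤ guard (does d) y
guard-≤ (yes p) h = h p
guard-≤ (no _)  h = z≤n

Σ<-mono : ∀ {n} {f g : Fin n → Fin n → ℕ} → (∀ u v → u F.< v → f u v ≤ g u v) → Σ< f ≤ Σ< g
Σ<-mono h = Σ-mono (λ u → Σ-mono (λ v → guard-≤ (u F.<? v) (h u v)))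

Σ<-cong : ∀ {n} {f g : Fin n → Fin n → ℕ} → (∀ u v → u F.< v → f u v ≡ g u v) → Σ< f ≡ Σ< g
Σ<-cong h = ≤-antisym (Σ<-mono (λ u v p → ≤-reflexive (h u v p)))
                      (Σ<-mono (λ u v p → ≤-reflexive (sym (h u v p))))

ΣΣ-+ : ∀ {n} (f g : Fin n → Fin n → ℕ) → ΣΣ (λ u v → f u v + g u v) ≡ ΣΣ f + ΣΣ g
ΣΣ-+ {n} f g = trans (Σ-cong (λ u → Σ-+ (f u) (g u))) (Σ-+ (λ u → Σ[ n ] (f u)) (λ u → Σ[ n ] (g u)))

Σ<-+ : ∀ {n} (f g : Fin n → Fin n → ℕ) → Σ< (λ u v → f u v + g u v) ≡ Σ< f + Σ< g
Σ<-+ f g = trans (Σ-cong (λ u → Σ-cong (λ v → guard-+ {f u v} {g u v} (does (u F.<? v)))))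
                 (ΣΣ-+ (λ u v → guard (does (u F.<? v)) (f u v)) (λ u v → guard (does (u F.<? v)) (g u v)))
  where
  guard-+ : ∀ {x y} b → guard b (x + y) ≡ guard b x + guard b y
  guard-+ true  = refl
  guard-+ false = refl

ΣΣ-split : ∀ {n} (f : Fin n → Fin n → ℕ) →
  ΣΣ f ≡ Σ< (λ u v → f u v + f v u) + Σ[ n ] (λ u → f u u)
ΣΣ-split {zero}  f = refl
ΣΣ-split {suc n} f = begin
  (f zero zero + R) + Σ[ n ] (λ u → f (suc u) zero + Σ[ n ] (f' u))
    ≡⟨ cong ((f zero zero + R) +_) (Σ-+ (λ u → f (suc u) zero) (λ u → Σ[ n ] (f' u))) ⟩
  (f zero zero + R) + (L + ΣΣ f')
    ≡⟨ cong (λ x → (f zero zero + R) + (L + x)) (ΣΣ-split f') ⟩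
  (f zero zero + R) + (L + (P + D))
    ≡⟨ rearrange (f zero zero) R L P D ⟩
  ((R + L) + P) + (f zero zero + D)
    ≡⟨ cong (λ x → (x + P) + (f zero zero + D)) (sym (Σ-+ (λ v → f zero (suc v)) (λ v → f (suc v) zero))) ⟩
  Σ< (λ u v → f u v + f v u) + Σ[ suc n ] (λ u → f u u) ∎
  where
  open ≡-Reasoning
  f' : Fin n → Fin n → ℕ
  f' u v = f (suc u) (suc v)
  R = Σ[ n ] (λ v → f zero (suc v))
  L = Σ[ n ] (λ u → f (suc u) zero)
  P = Σ< (λ u v → f' u v + f' v u)
  D = Σ[ n ] (λ u → f' u u)
  rearrange : ∀ x r l p d → (x + r) + (l + (p + d)) ≡ ((r + l) + p) + (x + d)
  rearrange = solve-∀

guard-Σ : ∀ {n} b (f : Fin n → ℕ) → guard b (Σ[ n ] f) ≡ Σ[ n ] (λ i → guard b (f i))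
guard-Σ true  f = refl
guard-Σ {n} false f = sym (Σ-zero {n} (λ _ → refl))

witness : ∀ {P : Set} (d : Dec P) → does d ≡ true → P
witness (yes p) _ = p

refutation : ∀ {P : Set} (d : Dec P) → does d ≡ false → ¬ P
refutation (no ¬p) _ = ¬p

∈⇒lookup : ∀ {n} {u : Fin n} {S : Subset n} → u ∈ S → lookup S u ≡ true
∈⇒lookup = []=⇒lookup

lookup⇒∈ : ∀ {n} {u : Fin n} {S : Subset n} → lookup S u ≡ true → u ∈ S
lookup⇒∈ {u = u} {S} = lookup⇒[]= u S

lookup⇒∉ : ∀ {n} {u : Fin n} {S : Subset n} → lookup S u ≡ false → u ∉ S
lookup⇒∉ e u∈S with () ← trans (sym e) (∈⇒lookup u∈S)

∉⇒lookup : ∀ {n} {u : Fin n} {S : Subset n} → u ∉ S → lookup S u ≡ false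
∉⇒lookup {u = u} {S} u∉S with lookup S u in e
... | true  = ⊥-elim (u∉S (lookup⇒∈ e))
... | false = refl

does-∈? : ∀ {n} (u : Fin n) (S : Subset n) → does (u ∈? S) ≡ lookup S u
does-∈? u S with lookup S u in e
... | true  = dec-true  (u ∈? S) (lookup⇒∈ e)
... | false = dec-false (u ∈? S) (lookup⇒∉ e)

ΣS-lookup : ∀ {n} (X : Subset n) (f : Fin n → ℕ) → ΣS X f ≡ Σ[ n ] (λ u → guard (lookup X u) (f u))
ΣS-lookup X f = Σ-cong (λ u → cong (λ b → guard b (f u)) (does-∈? u X))

ΣS-ΣS : ∀ {n} (X Y : Subset n) (f : Fin n → Fin n → ℕ) →
  ΣS X (λ u → ΣS Y (f u)) ≡ ΣΣ (λ u v → guard (lookup X u) (guard (lookup Y v) (f u v)))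
ΣS-ΣS X Y f = trans (ΣS-lookup X (λ u → ΣS Y (f u))) (Σ-cong (λ u →
  trans (cong (guard (lookup X u)) (ΣS-lookup Y (f u)))
        (guard-Σ (lookup X u) (λ v → guard (lookup Y v) (f u v)))))

ΣPairs-Σ< : ∀ {n} (X : Subset n) (g : Fin n → Fin n → ℕ) →
  ΣPairs X g ≡ Σ< (λ u v → guard (lookup X u) (guard (lookup X v) (g u v)))
ΣPairs-Σ< X g = trans (ΣS-ΣS X X (λ u v → guard (does (u F.<? v)) (g u v)))
  (Σ-cong (λ u → Σ-cong (λ v → reorder (lookup X u) (lookup X v) (does (u F.<? v)) (g u v))))
  where
  reorder : ∀ x y z c → guard x (guard y (guard z c)) ≡ guard z (guard x (guard y c))
  reorder true  true  true  c = refl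
  reorder true  true  false c = refl
  reorder true  false true  c = refl
  reorder true  false false c = refl
  reorder false true  true  c = refl
  reorder false true  false c = refl
  reorder false false true  c = refl
  reorder false false false c = refl

-- A sum over ordered pairs (u,v) with u ∈ X, v ∈ Y, for disjoint X and Y,
-- is a sum over unordered pairs: the diagonal does not contribute.

ΣΣ-disjoint : ∀ {n} (x y : Fin n → Bool) (f : Fin n → Fin n → ℕ) →
  (∀ u → x u ≡ true → y u ≡ false) →
  ΣΣ (λ u v → guard (x u) (guard (y v) (f u v)))
  ≡ Σ< (λ u v → guard (x u) (guard (y v) (f u v)) + guard (x v) (guard (y u) (f v u)))
ΣΣ-disjoint {n} x y f disj = begin
  ΣΣ g
    ≡⟨ ΣΣ-split g ⟩
  Σ< (λ u v → g u v + g v u) + Σ[ n ] (λ u → g u u)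
    ≡⟨ cong (Σ< (λ u v → g u v + g v u) +_) (Σ-zero no-loop) ⟩
  Σ< (λ u v → g u v + g v u) + 0
    ≡⟨ +-identityʳ _ ⟩
  Σ< (λ u v → g u v + g v u) ∎
  where
  open ≡-Reasoning
  g : Fin n → Fin n → ℕ
  g u v = guard (x u) (guard (y v) (f u v))
  no-loop : ∀ u → g u u ≡ 0
  no-loop u with x u in xu
  ... | true  rewrite disj u xu = refl
  ... | false = refl

-- The status of a vertex u with respect to a set S in the trigraph G[U].
-- wt U w S only depends on these statuses: chosen vertices contribute their
-- own weight, and a pair contributes according to the statuses of its ends.

data Status : Set where
  chosen free outside : Status

status : (inS inU : Bool) → Status
status true  _     = chosen
status false true  = free
status false false = outside

σ[_,_] : ∀ {n} → Subset n → Subset n → Fin n → Status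
σ[ U , S ] u = status (lookup S u) (lookup U u)

isChosen isFree : Status → Bool
isChosen chosen = true
isChosen _      = false
isFree free = true
isFree _    = false

lookup-chosen : ∀ {n} (U S : Subset n) u → lookup S u ≡ isChosen (σ[ U , S ] u)
lookup-chosen U S u with lookup S u | lookup U u
... | true  | _     = refl
... | false | true  = refl
... | false | false = refl

lookup-free : ∀ {n} (U S : Subset n) u → lookup (U ─ S) u ≡ isFree (σ[ U , S ] u)
lookup-free (x     ∷ U) (true  ∷ S) zero    = refl
lookup-free (true  ∷ U) (false ∷ S) zero    = refl
lookup-free (false ∷ U) (false ∷ S) zero    = refl
lookup-free (_     ∷ U) (_     ∷ S) (suc u) = lookup-free U S u

-- Contribution of a vertex, and of a pair {u,v} with weights
-- a = w(u,v), b = w(v,u), c = w(uv).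

chosenWt : Status → ℕ → ℕ
chosenWt σ x = guard (isChosen σ) x

pairWt : Status → Status → (a b c : ℕ) → ℕ
pairWt chosen free   a b c = a
pairWt free   chosen a b c = b
pairWt free   free   a b c = c
pairWt _      _      _ _ _ = 0

pairWt-parts : ∀ σ τ a b c → pairWt σ τ a b c ≡
  (guard (isChosen σ) (guard (isFree τ) a) + guard (isChosen τ) (guard (isFree σ) b))
  + guard (isFree σ) (guard (isFree τ) c)
pairWt-parts chosen  chosen  a b c = refl
pairWt-parts chosen  free    a b c = sym (trans (+-identityʳ (a + 0)) (+-identityʳ a))
pairWt-parts chosen  outside a b c = refl
pairWt-parts free    chosen  a b c = sym (+-identityʳ b)
pairWt-parts free    free    a b c = refl
pairWt-parts free    outside a b c = refl
pairWt-parts outside chosen  a b c = refl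
pairWt-parts outside free    a b c = refl
pairWt-parts outside outside a b c = refl

vertexTerm : ∀ {n} → Weights n → (Fin n → Status) → Fin n → ℕ
vertexTerm w σ u = chosenWt (σ u) (wv w u)

pairTerm : ∀ {n} → Weights n → (Fin n → Status) → Fin n → Fin n → ℕ
pairTerm w σ u v = pairWt (σ u) (σ v) (wo w u v) (wo w v u) (wu w u v)

wt-local : ∀ {n} (U : Subset n) (w : Weights n) (S : Subset n) →
  wt U w S ≡ Σ[ n ] (vertexTerm w σ[ U , S ]) + Σ< (pairTerm w σ[ U , S ])
wt-local {n} U w S = begin
  (ΣS S (wv w) + ΣS S (λ u → ΣS (U ─ S) (wo w u))) + ΣPairs (U ─ S) (wu w)
    ≡⟨ cong₂ _+_ (cong₂ _+_ vertices (ΣS-ΣS S (U ─ S) (wo w))) (ΣPairs-Σ< (U ─ S) (wu w)) ⟩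
  (Σ[ n ] (vertexTerm w σ) + ΣΣ (λ u v → guard (s u) (guard (f v) (wo w u v)))) + Σ< free²
    ≡⟨ cong (λ x → (Σ[ n ] (vertexTerm w σ) + x) + Σ< free²) (ΣΣ-disjoint s f (wo w) disjoint) ⟩
  (Σ[ n ] (vertexTerm w σ) + Σ< cross²) + Σ< free²
    ≡⟨ +-assoc (Σ[ n ] (vertexTerm w σ)) (Σ< cross²) (Σ< free²) ⟩
  Σ[ n ] (vertexTerm w σ) + (Σ< cross² + Σ< free²)
    ≡⟨ cong (Σ[ n ] (vertexTerm w σ) +_) (sym (Σ<-+ cross² free²)) ⟩
  Σ[ n ] (vertexTerm w σ) + Σ< (λ u v → cross² u v + free² u v)
    ≡⟨ cong (Σ[ n ] (vertexTerm w σ) +_) (Σ-cong (λ u → Σ-cong (λ v →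
         cong (guard (does (u F.<? v))) (local u v)))) ⟩
  Σ[ n ] (vertexTerm w σ) + Σ< (pairTerm w σ) ∎
  where
  open ≡-Reasoning
  σ = σ[ U , S ]
  s f : Fin n → Bool
  s = lookup S
  f = lookup (U ─ S)
  cross² : Fin n → Fin n → ℕ
  cross² u v = guard (s u) (guard (f v) (wo w u v)) + guard (s v) (guard (f u) (wo w v u))
  free² : Fin n → Fin n → ℕ
  free² u v = guard (f u) (guard (f v) (wu w u v))
  vertices : ΣS S (wv w) ≡ Σ[ n ] (vertexTerm w σ)
  vertices = trans (ΣS-lookup S (wv w)) (Σ-cong (λ u → cong (λ b → guard b (wv w u)) (lookup-chosen U S u)))
  disjoint : ∀ u → s u ≡ true → f u ≡ false
  disjoint u su = trans (lookup-free U S u) (cong (λ b → isFree (status b (lookup U u))) su)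
  local : ∀ u v → cross² u v + free² u v ≡ pairTerm w σ u v
  local u v = trans
    (cong₂ _+_ (cong₂ _+_ (guard² (lookup-chosen U S u) (lookup-free U S v) (wo w u v))
                          (guard² (lookup-chosen U S v) (lookup-free U S u) (wo w v u)))
               (guard² (lookup-free U S u) (lookup-free U S v) (wu w u v)))
    (sym (pairWt-parts (σ u) (σ v) (wo w u v) (wo w v u) (wu w u v)))
    where
    guard² : ∀ {p p' q q'} → p ≡ p' → q ≡ q' → ∀ x → guard p (guard q x) ≡ guard p' (guard q' x)
    guard² refl refl x = refl

local-≤ : ∀ {n} {f g : Fin n → ℕ} {p q : Fin n → Fin n → ℕ} →
  (∀ u → f u ≤ g u) → (∀ u v → u F.< v → p u v ≤ q u v) → Σ[ n ] f + Σ< p ≤ Σ[ n ] g + Σ< q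
local-≤ hf hp = +-mono-≤ (Σ-mono hf) (Σ<-mono hp)

wt₂-local : ∀ {n} (U₁ : Subset n) (w₁ : Weights n) (S₁ U₂ : Subset n) (w₂ : Weights n) (S₂ : Subset n) →
  wt U₁ w₁ S₁ + wt U₂ w₂ S₂
  ≡ Σ[ n ] (λ u → vertexTerm w₁ σ[ U₁ , S₁ ] u + vertexTerm w₂ σ[ U₂ , S₂ ] u)
    + Σ< (λ u v → pairTerm w₁ σ[ U₁ , S₁ ] u v + pairTerm w₂ σ[ U₂ , S₂ ] u v)
wt₂-local U₁ w₁ S₁ U₂ w₂ S₂ = begin
  wt U₁ w₁ S₁ + wt U₂ w₂ S₂
    ≡⟨ cong₂ _+_ (wt-local U₁ w₁ S₁) (wt-local U₂ w₂ S₂) ⟩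
  (Σ[ _ ] V₁ + Σ< P₁) + (Σ[ _ ] V₂ + Σ< P₂)
    ≡⟨ interchange (Σ[ _ ] V₁) (Σ< P₁) (Σ[ _ ] V₂) (Σ< P₂) ⟩
  (Σ[ _ ] V₁ + Σ[ _ ] V₂) + (Σ< P₁ + Σ< P₂)
    ≡⟨ sym (cong₂ _+_ (Σ-+ V₁ V₂) (Σ<-+ P₁ P₂)) ⟩
  Σ[ _ ] (λ u → V₁ u + V₂ u) + Σ< (λ u v → P₁ u v + P₂ u v) ∎
  where
  open ≡-Reasoning
  V₁ = vertexTerm w₁ σ[ U₁ , S₁ ]
  V₂ = vertexTerm w₂ σ[ U₂ , S₂ ]
  P₁ = pairTerm w₁ σ[ U₁ , S₁ ]
  P₂ = pairTerm w₂ σ[ U₂ , S₂ ]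

-- The part of being a weight function on U that the comparisons use:
-- w(uv) is symmetric and dominates w(u,v).

Dominated : ∀ {n} → Subset n → Weights n → Set
Dominated U w = ∀ u v → u ∈ U → v ∈ U → u ≢ v → wu w u v ≡ wu w v u × wo w u v ≤ wu w u v

weight⇒dominated : ∀ {n} {G : Trigraph n} {U : Subset n} {w : Weights n} → IsWeight G U w → Dominated U w
weight⇒dominated isw u v u∈U v∈U u≢v = proj₁ (isw u v u∈U v∈U u≢v) , proj₂ (proj₂ (isw u v u∈U v∈U u≢v))

pair-bounds : ∀ {n} {U : Subset n} {w : Weights n} {u v : Fin n} → Dominated U w →
  u ∈ U → v ∈ U → u ≢ v → wo w u v ≤ wu w u v × wo w v u ≤ wu w u v
pair-bounds {w = w} {u} {v} dom u∈U v∈U u≢v =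
  proj₂ (dom u v u∈U v∈U u≢v) ,
  subst (wo w v u ≤_) (sym (proj₁ (dom u v u∈U v∈U u≢v))) (proj₂ (dom v u v∈U u∈U (λ e → u≢v (sym e))))

-- Releasing chosen vertices: σ ⇝ σ' when σ' = σ or a chosen vertex became
-- free.  If w(u,v) ≤ w(uv) ≥ w(v,u), releasing never decreases the weight
-- of a pair.

data _⇝_ : Status → Status → Set where
  keep    : ∀ {σ} → σ ⇝ σ
  release : chosen ⇝ free

Present : Status → Set
Present outside = ⊥
Present _       = Unit

pairWt-release : ∀ {σ σ' τ τ'} {a b c : ℕ} → σ ⇝ σ' → τ ⇝ τ' →
  (Present σ → Present τ → a ≤ c × b ≤ c) → pairWt σ τ a b c ≤ pairWt σ' τ' a b c
pairWt-release         keep    keep    h = ≤-refl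
pairWt-release {τ = chosen}  release keep    h = z≤n
pairWt-release {τ = free}    release keep    h = proj₁ (h tt tt)
pairWt-release {τ = outside} release keep    h = z≤n
pairWt-release {σ = chosen}  keep    release h = z≤n
pairWt-release {σ = free}    keep    release h = proj₂ (h tt tt)
pairWt-release {σ = outside} keep    release h = z≤n
pairWt-release         release release h = z≤n

pairWt-zero : ∀ σ τ → pairWt σ τ 0 0 0 ≡ 0
pairWt-zero chosen  chosen  = refl
pairWt-zero chosen  free    = refl
pairWt-zero chosen  outside = refl
pairWt-zero free    chosen  = refl
pairWt-zero free    free    = refl
pairWt-zero free    outside = refl
pairWt-zero outside τ       = refl

pairWt-outsideʳ : ∀ σ a b c → pairWt σ outside a b c ≡ 0
pairWt-outsideʳ chosen  a b c = refl
pairWt-outsideʳ free    a b c = refl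
pairWt-outsideʳ outside a b c = refl

status-shrink : ∀ s s' x → (s' ≡ true → s ≡ true) → (s ≡ true → x ≡ true) → status s x ⇝ status s' x
status-shrink true  true  x     _ _ = keep
status-shrink true  false x     _ h rewrite h refl = release
status-shrink false true  x     h _ with () ← h refl
status-shrink false false x     _ _ = keep

shrink : ∀ {n} {U S S' : Subset n} → S' ⊆ S → S ⊆ U → ∀ u → σ[ U , S ] u ⇝ σ[ U , S' ] u
shrink {U = U} {S} {S'} S'⊆S S⊆U u = status-shrink (lookup S u) (lookup S' u) (lookup U u)
  (λ e → ∈⇒lookup (S'⊆S (lookup⇒∈ e))) (λ e → ∈⇒lookup (S⊆U (lookup⇒∈ e)))

present⇒∈ : ∀ {n} {U S : Subset n} → S ⊆ U → ∀ u → Present (σ[ U , S ] u) → u ∈ U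
present⇒∈ {U = U} {S} S⊆U u p = lookup⇒∈ (go (lookup S u) (lookup U u) (λ e → ∈⇒lookup (S⊆U (lookup⇒∈ e))) p)
  where
  go : ∀ s x → (s ≡ true → x ≡ true) → Present (status s x) → x ≡ true
  go true  x     h _ = h refl
  go false true  h _ = refl

present-bounds : ∀ {n} {U S : Subset n} {w : Weights n} → S ⊆ U → Dominated U w → ∀ {u v} → u F.< v →
  Present (σ[ U , S ] u) → Present (σ[ U , S ] v) → wo w u v ≤ wu w u v × wo w v u ≤ wu w u v
present-bounds {U = U} {w = w} S⊆U dom {u} {v} u<v pu pv =
  pair-bounds {U = U} {w} dom (present⇒∈ S⊆U u pu) (present⇒∈ S⊆U v pv) (FinP.<⇒≢ u<v)

drop-zeros : ∀ {n} (U : Subset n) (w : Weights n) {S S' : Subset n} → S' ⊆ S → S ⊆ U → Dominated U w →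
  (∀ u → u ∈ S → u ∉ S' → wv w u ≡ 0) → wt U w S ≤ wt U w S'
drop-zeros U w {S} {S'} S'⊆S S⊆U dom zero-wt =
  subst₂ _≤_ (sym (wt-local U w S)) (sym (wt-local U w S')) (local-≤ vertex pair)
  where
  vertex : ∀ u → vertexTerm w σ[ U , S ] u ≤ vertexTerm w σ[ U , S' ] u
  vertex u = subst₂ (λ s s' → guard s (wv w u) ≤ guard s' (wv w u))
    (lookup-chosen U S u) (lookup-chosen U S' u)
    (guard-drop (lookup S u) (lookup S' u) (λ e → ∈⇒lookup (S'⊆S (lookup⇒∈ e)))
      (λ s s' → zero-wt u (lookup⇒∈ s) (lookup⇒∉ s')))
    where
    guard-drop : ∀ s s' → (s' ≡ true → s ≡ true) → (s ≡ true → s' ≡ false → wv w u ≡ 0) →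
      guard s (wv w u) ≤ guard s' (wv w u)
    guard-drop true  true  _ _ = ≤-refl
    guard-drop true  false _ h = ≤-reflexive (h refl refl)
    guard-drop false true  h _ with () ← h refl
    guard-drop false false _ _ = ≤-refl
  pair : ∀ u v → u F.< v → pairTerm w σ[ U , S ] u v ≤ pairTerm w σ[ U , S' ] u v
  pair u v u<v = pairWt-release (shrink S'⊆S S⊆U u) (shrink S'⊆S S⊆U v) (present-bounds {U = U} {S} {w} S⊆U dom u<v)

within : Bool → Status → Status
within true  σ = σ
within false _ = outside

σ-∩ : ∀ {n} (U U' S : Subset n) u → (lookup U' u ≡ true → lookup U u ≡ true) →
  σ[ U' , S ∩ U' ] u ≡ within (lookup U' u) (σ[ U , S ] u)
σ-∩ U U' S u h = trans (cong (λ b → status b (lookup U' u)) (lookup-zipWith _∧_ u S U'))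
  (status-∧ (lookup S u) (lookup U' u) (lookup U u) h)
  where
  status-∧ : ∀ s i x → (i ≡ true → x ≡ true) → status (s ∧ i) i ≡ within i (status s x)
  status-∧ true  true  x h = refl
  status-∧ false true  x h rewrite h refl = refl
  status-∧ true  false x h = refl
  status-∧ false false x h = refl

-- Let U' ⊆ U and Z ⊆ T ⊆ U where T differs from Z only
-- inside U'.  Releasing T ∖ Z costs at least as much in G[U'] as in G[U]:
--   wt_U(T) + wt_U'(Z ∩ U') ≤ wt_U(Z) + wt_U'(T ∩ U').

-- The local cases: i records whether u ∈ U', and outside U' nothing is
-- released.
exchange-vertex : ∀ i {σ σ'} x → σ ⇝ σ' → (i ≡ false → σ ≡ σ') →
  chosenWt σ x + chosenWt (within i σ') x ≤ chosenWt σ' x + chosenWt (within i σ) x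
exchange-vertex i     x keep    _ = ≤-refl
exchange-vertex true  x release _ = ≤-reflexive (+-identityʳ x)
exchange-vertex false x release h with () ← h refl

exchange-pair : ∀ i j {σ σ' τ τ'} {a b c : ℕ} → σ ⇝ σ' → τ ⇝ τ' →
  (i ≡ false → σ ≡ σ') → (j ≡ false → τ ≡ τ') → (Present σ → Present τ → a ≤ c × b ≤ c) →
  pairWt σ τ a b c + pairWt (within i σ') (within j τ') a b c
  ≤ pairWt σ' τ' a b c + pairWt (within i σ) (within j τ) a b c
exchange-pair true  true  {σ} {σ'} {τ} {τ'} {a} {b} {c} _ _ _ _ _ =
  ≤-reflexive (+-comm (pairWt σ τ a b c) (pairWt σ' τ' a b c))
exchange-pair false false _  _  hi hj _ rewrite hi refl | hj refl = ≤-refl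
exchange-pair false true  _  τ⇝ hi _  h with hi refl
... | refl = +-monoˡ-≤ 0 (pairWt-release keep τ⇝ h)
exchange-pair true  false {σ} {σ'} {_} {_} {a} {b} {c} σ⇝ _ _ hj h with hj refl
... | refl rewrite pairWt-outsideʳ σ a b c | pairWt-outsideʳ σ' a b c = +-monoˡ-≤ 0 (pairWt-release σ⇝ keep h)

exchange : ∀ {n} (U U' : Subset n) (w : Weights n) {T Z : Subset n} → U' ⊆ U → Z ⊆ T → T ⊆ U →
  (∀ u → u ∈ T → u ∉ Z → u ∈ U') → Dominated U w →
  wt U w T + wt U' w (Z ∩ U') ≤ wt U w Z + wt U' w (T ∩ U')
exchange U U' w {T} {Z} U'⊆U Z⊆T T⊆U T∖Z⊆U' dom =
  subst₂ _≤_ (sym (wt₂-local U w T U' w (Z ∩ U'))) (sym (wt₂-local U w Z U' w (T ∩ U')))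
    (local-≤ vertex pair)
  where
  in-U : ∀ u → lookup U' u ≡ true → lookup U u ≡ true
  in-U u e = ∈⇒lookup (U'⊆U (lookup⇒∈ e))
  unchanged : ∀ u → lookup U' u ≡ false → σ[ U , T ] u ≡ σ[ U , Z ] u
  unchanged u = fixed (lookup T u) (lookup Z u) (lookup U u) (lookup U' u)
    (λ e → ∈⇒lookup (Z⊆T (lookup⇒∈ e)))
    (λ t z → ∈⇒lookup (T∖Z⊆U' u (lookup⇒∈ t) (lookup⇒∉ z)))
    where
    fixed : ∀ t z x i → (z ≡ true → t ≡ true) → (t ≡ true → z ≡ false → i ≡ true) →
      i ≡ false → status t x ≡ status z x
    fixed true  true  x i _ _ _ = refl
    fixed true  false x i _ h e with () ← trans (sym (h refl refl)) e
    fixed false true  x i h _ _ with () ← h refl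
    fixed false false x i _ _ _ = refl
  vertex : ∀ u → chosenWt (σ[ U , T ] u) (wv w u) + chosenWt (σ[ U' , Z ∩ U' ] u) (wv w u)
               ≤ chosenWt (σ[ U , Z ] u) (wv w u) + chosenWt (σ[ U' , T ∩ U' ] u) (wv w u)
  vertex u rewrite σ-∩ U U' Z u (in-U u) | σ-∩ U U' T u (in-U u) =
    exchange-vertex (lookup U' u) (wv w u) (shrink Z⊆T T⊆U u) (unchanged u)
  pair : ∀ u v → u F.< v →
    pairWt (σ[ U , T ] u) (σ[ U , T ] v) (wo w u v) (wo w v u) (wu w u v)
    + pairWt (σ[ U' , Z ∩ U' ] u) (σ[ U' , Z ∩ U' ] v) (wo w u v) (wo w v u) (wu w u v)
    ≤ pairWt (σ[ U , Z ] u) (σ[ U , Z ] v) (wo w u v) (wo w v u) (wu w u v)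
    + pairWt (σ[ U' , T ∩ U' ] u) (σ[ U' , T ∩ U' ] v) (wo w u v) (wo w v u) (wu w u v)
  pair u v u<v rewrite σ-∩ U U' Z u (in-U u) | σ-∩ U U' Z v (in-U v)
                     | σ-∩ U U' T u (in-U u) | σ-∩ U U' T v (in-U v) =
    exchange-pair (lookup U' u) (lookup U' v) (shrink Z⊆T T⊆U u) (shrink Z⊆T T⊆U v)
      (unchanged u) (unchanged v) (present-bounds {U = U} {T} {w} T⊆U dom u<v)

-- For S ⊆ R ⊆ U, write Q = U ∖ R and
-- deficit(u) = Σ_{v ∈ Q} (w(uv) − w(u,v)), the amount Red[G[U],w;R]
-- subtracts from w(u).  Then
--   wt_U(S) + Σ_{u ∈ S} (deficit(u) ∸ w(u)) = wt_R(S) in Red + Ext(R):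
-- the weight lost by truncating w(u) − deficit(u) at 0 is the only
-- difference between S in G[U] and S in the reduced trigraph.

deficit : ∀ {n} → Subset n → Subset n → Weights n → Fin n → ℕ
deficit U R w u = ΣS (U ─ R) (λ v → wu w u v ∸ wo w u v)

data Layer : Set where
  selected retained external absent : Layer

inS inR inQ inU : Layer → Bool
inS selected = true
inS _        = false
inR selected = true
inR retained = true
inR _        = false
inQ external = true
inQ _        = false
inU absent = false
inU _      = true

Layered : ∀ {n} → Subset n → Subset n → Subset n → Fin n → Layer → Set
Layered U R S u ℓ =
  lookup S u ≡ inS ℓ × lookup R u ≡ inR ℓ × lookup (U ─ R) u ≡ inQ ℓ × lookup U u ≡ inU ℓ

layerOf : ∀ {n} {U R S : Subset n} → S ⊆ R → R ⊆ U → ∀ u → ∃ (Layered U R S u)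
layerOf {U = U} {R} {S} S⊆R R⊆U u =
  classify (lookup S u) (lookup R u) (lookup U u) (lookup-free U R u) (sub S⊆R) (sub R⊆U)
  where
  sub : ∀ {X Y : Subset _} → X ⊆ Y → lookup X u ≡ true → lookup Y u ≡ true
  sub X⊆Y e = ∈⇒lookup (X⊆Y (lookup⇒∈ e))
  classify : ∀ s r x {q} → q ≡ isFree (status r x) → (s ≡ true → r ≡ true) → (r ≡ true → x ≡ true) →
    ∃ λ ℓ → s ≡ inS ℓ × r ≡ inR ℓ × q ≡ inQ ℓ × x ≡ inU ℓ
  classify true  true  true  q _ _ = selected , refl , refl , q , refl
  classify true  false _     _ h _ with () ← h refl
  classify true  true  false _ _ h with () ← h refl
  classify false true  true  q _ _ = retained , refl , refl , q , refl
  classify false true  false _ _ h with () ← h refl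
  classify false false true  q _ _ = external , refl , refl , q , refl
  classify false false false q _ _ = absent , refl , refl , q , refl

-- The local identity for one pair u < v, with a = w(u,v), b = w(v,u),
-- c = w(uv), c' = w(vu): deficit terms plus pairs in G[U] equal pairs in
-- G[R] plus the Ext terms (pairs inside Q, pairs between R and Q).
reduction-pair : ∀ ℓ ℓ' {a b c c' : ℕ} →
  (inU ℓ ≡ true → inU ℓ' ≡ true → a ≤ c × b ≤ c' × c ≡ c') →
  pairWt (status (inS ℓ) (inU ℓ)) (status (inS ℓ') (inU ℓ')) a b c
  + (guard (inS ℓ) (guard (inQ ℓ') (c ∸ a)) + guard (inS ℓ') (guard (inQ ℓ) (c' ∸ b)))
  ≡ pairWt (status (inS ℓ) (inR ℓ)) (status (inS ℓ') (inR ℓ')) a b c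
  + (guard (inQ ℓ) (guard (inQ ℓ') c) + (guard (inR ℓ) (guard (inQ ℓ') c) + guard (inR ℓ') (guard (inQ ℓ) c')))
reduction-pair selected selected _ = refl
reduction-pair selected retained _ = refl
reduction-pair selected external {a} {c = c} h =
  trans (cong (a +_) (+-identityʳ (c ∸ a)))
        (trans (m+[n∸m]≡n (proj₁ (h refl refl))) (sym (+-identityʳ c)))
reduction-pair selected absent   _ = refl
reduction-pair retained selected _ = refl
reduction-pair retained retained _ = refl
reduction-pair retained external _ = refl
reduction-pair retained absent   _ = refl
reduction-pair external selected h = m+[n∸m]≡n (proj₁ (proj₂ (h refl refl)))
reduction-pair external retained {c = c} h = trans (+-identityʳ c) (proj₂ (proj₂ (h refl refl)))
reduction-pair external external _ = refl
reduction-pair external absent   _ = refl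
reduction-pair absent   selected _ = refl
reduction-pair absent   retained _ = refl
reduction-pair absent   external _ = refl
reduction-pair absent   absent   _ = refl

-- x + (d ∸ x) and (x ∸ d) + d are both max(x, d).
cap-swap : ∀ x d → x + (d ∸ x) ≡ (x ∸ d) + d
cap-swap x d with ≤-total x d
... | inj₁ x≤d rewrite m≤n⇒m∸n≡0 x≤d = m+[n∸m]≡n x≤d
... | inj₂ d≤x rewrite m≤n⇒m∸n≡0 d≤x = trans (+-identityʳ x) (sym (m∸n+n≡m d≤x))

-- Vertex part: truncation at 0 is compensated by the excess deficit ∸ w(u).
reduction-vertices : ∀ {n} (U R : Subset n) (w : Weights n) (S : Subset n) →
  Σ[ n ] (vertexTerm w σ[ U , S ]) + ΣS S (λ u → deficit U R w u ∸ wv w u)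
  ≡ Σ[ n ] (vertexTerm (Red-w U R w) σ[ R , S ]) + ΣS S (deficit U R w)
reduction-vertices {n} U R w S = begin
  Σ[ n ] (vertexTerm w σ[ U , S ]) + ΣS S excess
    ≡⟨ sym (Σ-+ (vertexTerm w σ[ U , S ]) (λ u → guard (does (u ∈? S)) (excess u))) ⟩
  Σ[ n ] (λ u → vertexTerm w σ[ U , S ] u + guard (does (u ∈? S)) (excess u))
    ≡⟨ Σ-cong local ⟩
  Σ[ n ] (λ u → vertexTerm (Red-w U R w) σ[ R , S ] u + guard (does (u ∈? S)) (deficit U R w u))
    ≡⟨ Σ-+ (vertexTerm (Red-w U R w) σ[ R , S ]) (λ u → guard (does (u ∈? S)) (deficit U R w u)) ⟩
  Σ[ n ] (vertexTerm (Red-w U R w) σ[ R , S ]) + ΣS S (deficit U R w) ∎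
  where
  open ≡-Reasoning
  excess : Fin n → ℕ
  excess u = deficit U R w u ∸ wv w u
  local : ∀ u → vertexTerm w σ[ U , S ] u + guard (does (u ∈? S)) (excess u)
              ≡ vertexTerm (Red-w U R w) σ[ R , S ] u + guard (does (u ∈? S)) (deficit U R w u)
  local u rewrite does-∈? u S | sym (lookup-chosen U S u) | sym (lookup-chosen R S u) with lookup S u
  ... | true  = cap-swap (wv w u) (deficit U R w u)
  ... | false = refl

R∩Q=∅ : ∀ {n} (U R : Subset n) u → lookup R u ≡ true → lookup (U ─ R) u ≡ false
R∩Q=∅ U R u e = trans (lookup-free U R u) (cong (λ b → isFree (status b (lookup U u))) e)

Ext-local : ∀ {n} (U R : Subset n) (w : Weights n) →
  Ext U w R ≡ Σ< (λ u v → guard (lookup (U ─ R) u) (guard (lookup (U ─ R) v) (wu w u v)))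
            + Σ< (λ u v → guard (lookup R u) (guard (lookup (U ─ R) v) (wu w u v))
                          + guard (lookup R v) (guard (lookup (U ─ R) u) (wu w v u)))
Ext-local U R w = cong₂ _+_ (ΣPairs-Σ< (U ─ R) (wu w))
  (trans (ΣS-ΣS R (U ─ R) (wu w)) (ΣΣ-disjoint (lookup R) (lookup (U ─ R)) (wu w) (R∩Q=∅ U R)))

reduction-pairs : ∀ {n} (U R : Subset n) (w : Weights n) {S : Subset n} → S ⊆ R → R ⊆ U → Dominated U w →
  ΣS S (deficit U R w) + Σ< (pairTerm w σ[ U , S ]) ≡ Σ< (pairTerm w σ[ R , S ]) + Ext U w R
reduction-pairs {n} U R w {S} S⊆R R⊆U dom = begin
  ΣS S (deficit U R w) + Σ< Pᵤ
    ≡⟨ cong (_+ Σ< Pᵤ) (trans (ΣS-ΣS S (U ─ R) (λ u v → wu w u v ∸ wo w u v))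
                              (ΣΣ-disjoint s q (λ u v → wu w u v ∸ wo w u v) S∩Q=∅)) ⟩
  Σ< D² + Σ< Pᵤ
    ≡⟨ trans (+-comm (Σ< D²) (Σ< Pᵤ)) (sym (Σ<-+ Pᵤ D²)) ⟩
  Σ< (λ u v → Pᵤ u v + D² u v)
    ≡⟨ Σ<-cong local ⟩
  Σ< (λ u v → Pᵣ u v + (QQ u v + RQ² u v))
    ≡⟨ trans (Σ<-+ Pᵣ (λ u v → QQ u v + RQ² u v)) (cong (Σ< Pᵣ +_) (Σ<-+ QQ RQ²)) ⟩
  Σ< Pᵣ + (Σ< QQ + Σ< RQ²)
    ≡⟨ cong (Σ< Pᵣ +_) (sym (Ext-local U R w)) ⟩
  Σ< Pᵣ + Ext U w R ∎
  where
  open ≡-Reasoning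
  Pᵤ = pairTerm w σ[ U , S ]
  Pᵣ = pairTerm w σ[ R , S ]
  s q r : Fin n → Bool
  s = lookup S
  q = lookup (U ─ R)
  r = lookup R
  S∩Q=∅ : ∀ u → s u ≡ true → q u ≡ false
  S∩Q=∅ u e = R∩Q=∅ U R u (∈⇒lookup (S⊆R (lookup⇒∈ e)))
  D² QQ RQ² : Fin n → Fin n → ℕ
  D² u v = guard (s u) (guard (q v) (wu w u v ∸ wo w u v)) + guard (s v) (guard (q u) (wu w v u ∸ wo w v u))
  QQ u v = guard (q u) (guard (q v) (wu w u v))
  RQ² u v = guard (r u) (guard (q v) (wu w u v)) + guard (r v) (guard (q u) (wu w v u))
  local : ∀ u v → u F.< v → Pᵤ u v + D² u v ≡ Pᵣ u v + (QQ u v + RQ² u v)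
  local u v u<v with layerOf {U = U} {R} {S} S⊆R R⊆U u | layerOf {U = U} {R} {S} S⊆R R⊆U v
  ... | ℓ , su , ru , qu , xu | ℓ' , sv , rv , qv , xv
    rewrite su | ru | qu | xu | sv | rv | qv | xv =
    reduction-pair ℓ ℓ' (λ ℓ∈U ℓ'∈U → bounds (lookup⇒∈ (trans xu ℓ∈U)) (lookup⇒∈ (trans xv ℓ'∈U)))
    where
    bounds : u ∈ U → v ∈ U → wo w u v ≤ wu w u v × wo w v u ≤ wu w v u × wu w u v ≡ wu w v u
    bounds u∈U v∈U = proj₂ (dom u v u∈U v∈U (FinP.<⇒≢ u<v)) ,
                     proj₂ (dom v u v∈U u∈U (λ e → FinP.<⇒≢ u<v (sym e))) ,
                     proj₁ (dom u v u∈U v∈U (FinP.<⇒≢ u<v))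

reduction : ∀ {n} (U R : Subset n) (w : Weights n) {S : Subset n} → S ⊆ R → R ⊆ U → Dominated U w →
  wt U w S + ΣS S (λ u → deficit U R w u ∸ wv w u) ≡ wt R (Red-w U R w) S + Ext U w R
reduction {n} U R w {S} S⊆R R⊆U dom = begin
  wt U w S + ΣS S excess
    ≡⟨ cong (_+ ΣS S excess) (wt-local U w S) ⟩
  (Σ[ n ] Vᵤ + Σ< Pᵤ) + ΣS S excess
    ≡⟨ swap-last (Σ[ n ] Vᵤ) (Σ< Pᵤ) (ΣS S excess) ⟩
  (Σ[ n ] Vᵤ + ΣS S excess) + Σ< Pᵤ
    ≡⟨ cong (_+ Σ< Pᵤ) (reduction-vertices U R w S) ⟩
  (Σ[ n ] Vᵣ + ΣS S (deficit U R w)) + Σ< Pᵤ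
    ≡⟨ +-assoc (Σ[ n ] Vᵣ) (ΣS S (deficit U R w)) (Σ< Pᵤ) ⟩
  Σ[ n ] Vᵣ + (ΣS S (deficit U R w) + Σ< Pᵤ)
    ≡⟨ cong (Σ[ n ] Vᵣ +_) (reduction-pairs U R w S⊆R R⊆U dom) ⟩
  Σ[ n ] Vᵣ + (Σ< Pᵣ + Ext U w R)
    ≡⟨ sym (+-assoc (Σ[ n ] Vᵣ) (Σ< Pᵣ) (Ext U w R)) ⟩
  (Σ[ n ] Vᵣ + Σ< Pᵣ) + Ext U w R
    ≡⟨ cong (_+ Ext U w R) (sym (wt-local R (Red-w U R w) S)) ⟩
  wt R (Red-w U R w) S + Ext U w R ∎
  where
  open ≡-Reasoning
  excess : Fin n → ℕ
  excess u = deficit U R w u ∸ wv w u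
  Vᵤ = vertexTerm w σ[ U , S ]
  Pᵤ = pairTerm w σ[ U , S ]
  Vᵣ = vertexTerm (Red-w U R w) σ[ R , S ]
  Pᵣ = pairTerm (Red-w U R w) σ[ R , S ]
  swap-last : ∀ a b c → (a + b) + c ≡ (a + c) + b
  swap-last = solve-∀

maxSub-≥ : ∀ n (f : Subset n → ℕ) S → f S ≤ maxSub n f
maxSub-≥ zero    f []          = ≤-refl
maxSub-≥ (suc n) f (false ∷ S) = ≤-trans (maxSub-≥ n (λ S → f (false ∷ S)) S) (m≤m⊔n _ _)
maxSub-≥ (suc n) f (true  ∷ S) = ≤-trans (maxSub-≥ n (λ S → f (true ∷ S)) S) (m≤n⊔m _ _)

maxSub-attained : ∀ n (f : Subset n → ℕ) → ∃ λ S → maxSub n f ≡ f S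
maxSub-attained zero    f = [] , refl
maxSub-attained (suc n) f with ⊔-sel (maxSub n (λ S → f (false ∷ S))) (maxSub n (λ S → f (true ∷ S)))
... | inj₁ e = let (S , e') = maxSub-attained n (λ S → f (false ∷ S)) in false ∷ S , trans e e'
... | inj₂ e = let (S , e') = maxSub-attained n (λ S → f (true ∷ S)) in true ∷ S , trans e e'

α-≥ : ∀ {n} (G : Trigraph n) (U : Subset n) (w : Weights n) (S : Subset n) →
  S ⊆ U → Stable G S → wt U w S ≤ α G U w
α-≥ {n} G U w S S⊆U st = subst (_≤ α G U w) value (maxSub-≥ n _ S)
  where
  value : (if does ((S ⊆? U) ×-dec stable? G S) then wt U w S else 0) ≡ wt U w S
  value rewrite dec-true ((S ⊆? U) ×-dec stable? G S) (S⊆U , st) = refl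

α-attained : ∀ {n} (G : Trigraph n) (U : Subset n) (w : Weights n) →
  ∃ λ S → S ⊆ U × Stable G S × α G U w ≤ wt U w S
α-attained {n} G U w = candidate S ((S ⊆? U) ×-dec stable? G S) αS
  where
  S = proj₁ (maxSub-attained n (λ S → if does ((S ⊆? U) ×-dec stable? G S) then wt U w S else 0))
  αS = proj₂ (maxSub-attained n (λ S → if does ((S ⊆? U) ×-dec stable? G S) then wt U w S else 0))
  candidate : ∀ S (d : Dec (S ⊆ U × Stable G S)) → α G U w ≡ (if does d then wt U w S else 0) →
    ∃ λ S → S ⊆ U × Stable G S × α G U w ≤ wt U w S
  candidate S (yes (S⊆U , st)) e = S , S⊆U , st , ≤-reflexive e
  candidate S (no _)           e = ∅ , (λ x → ⊥-elim (∉⊥ x)) , (λ u v x _ _ → ⊥-elim (∉⊥ x)) , ≤-trans (≤-reflexive e) z≤n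

stable-⊆ : ∀ {n} {H : Trigraph n} {S S' : Subset n} → S' ⊆ S → Stable H S → Stable H S'
stable-⊆ S'⊆S st u v u∈S' v∈S' = st u v (S'⊆S u∈S') (S'⊆S v∈S')

-- β(R) := αRed + Ext is the largest weight, in G[U], of a stable set inside R.

β-upper : ∀ {n} (H : Trigraph n) (U R : Subset n) (w : Weights n) {S : Subset n} →
  S ⊆ R → R ⊆ U → Dominated U w → Stable H S → wt U w S ≤ αRed H U w R + Ext U w R
β-upper H U R w {S} S⊆R R⊆U dom st = begin
  wt U w S                                                 ≤⟨ m≤m+n (wt U w S) _ ⟩
  wt U w S + ΣS S (λ u → deficit U R w u ∸ wv w u)        ≡⟨ reduction U R w S⊆R R⊆U dom ⟩
  wt R (Red-w U R w) S + Ext U w R                          ≤⟨ +-monoˡ-≤ (Ext U w R) (α-≥ H R (Red-w U R w) S S⊆R st) ⟩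
  αRed H U w R + Ext U w R                                  ∎
  where open ≤-Reasoning

-- The vertices whose weight covers their deficit: on them Red does not
-- truncate, elsewhere the reduced weight is 0.

affordable : ∀ {n} → Subset n → Subset n → Weights n → Subset n
affordable U R w = tabulate (λ u → does (deficit U R w u ≤? wv w u))

covered : ∀ {n} (U R : Subset n) (w : Weights n) u → u ∈ affordable U R w → deficit U R w u ≤ wv w u
covered U R w u u∈A = witness (deficit U R w u ≤? wv w u)
  (trans (sym (lookup∘tabulate (λ u → does (deficit U R w u ≤? wv w u)) u)) (∈⇒lookup u∈A))

uncovered : ∀ {n} (U R : Subset n) (w : Weights n) u → u ∉ affordable U R w → wv (Red-w U R w) u ≡ 0
uncovered U R w u u∉A = m≤n⇒m∸n≡0 (<⇒≤ (≰⇒> (refutation (deficit U R w u ≤? wv w u)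
  (trans (sym (lookup∘tabulate (λ u → does (deficit U R w u ≤? wv w u)) u)) (∉⇒lookup u∉A)))))

-- Restricting an optimal set of the reduced problem to its affordable
-- vertices attains β(R) in G[U].
β-attained : ∀ {n} (H : Trigraph n) (U R : Subset n) (w : Weights n) → R ⊆ U → Dominated U w →
  ∃ λ S → S ⊆ R × Stable H S × αRed H U w R + Ext U w R ≤ wt U w S
β-attained {n} H U R w R⊆U dom = S , S⊆R , stable-⊆ {H = H} (p∩q⊆p S₀ A) S₀-stable , bound
  where
  open ≤-Reasoning
  w' = Red-w U R w
  optimal = α-attained H R w'
  S₀ = proj₁ optimal
  S₀⊆R = proj₁ (proj₂ optimal)
  S₀-stable = proj₁ (proj₂ (proj₂ optimal))
  A = affordable U R w
  S = S₀ ∩ A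
  S⊆R : S ⊆ R
  S⊆R u∈S = S₀⊆R (p∩q⊆p S₀ A u∈S)
  no-excess : ΣS S (λ u → deficit U R w u ∸ wv w u) ≡ 0
  no-excess = Σ-zero {n} (λ u → excess-zero u (u ∈? S))
    where
    excess-zero : ∀ u (d : Dec (u ∈ S)) → guard (does d) (deficit U R w u ∸ wv w u) ≡ 0
    excess-zero u (yes u∈S) = m≤n⇒m∸n≡0 (covered U R w u (proj₂ (x∈p∩q⁻ S₀ A u∈S)))
    excess-zero u (no  _)   = refl
  bound : αRed H U w R + Ext U w R ≤ wt U w S
  bound = begin
    αRed H U w R + Ext U w R
      ≤⟨ +-monoˡ-≤ (Ext U w R) (proj₂ (proj₂ (proj₂ optimal))) ⟩
    wt R w' S₀ + Ext U w R
      ≤⟨ +-monoˡ-≤ (Ext U w R) (drop-zeros R w' (p∩q⊆p S₀ A) S₀⊆R (λ u v u∈R v∈R → dom u v (R⊆U u∈R) (R⊆U v∈R))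
           (λ u u∈S₀ u∉S → uncovered U R w u (λ u∈A → u∉S (x∈p∩q⁺ (u∈S₀ , u∈A))))) ⟩
    wt R w' S + Ext U w R
      ≡⟨ sym (reduction U R w S⊆R R⊆U dom) ⟩
    wt U w S + ΣS S (λ u → deficit U R w u ∸ wv w u)
      ≡⟨ cong (wt U w S +_) no-excess ⟩
    wt U w S + 0
      ≡⟨ +-identityʳ (wt U w S) ⟩
    wt U w S ∎

-- Every pair of vertices lies
-- inside A ∪ C or inside B ∪ C (pairs across the cut carry no weight), and
-- the pairs inside C are counted in both; subtracting them once with the
-- weights of w_B gives, for every S,
--   wt_G(S) + wt_{C,w_B}(S ∩ C) = wt_{A∪C,w}(S ∩ (A∪C)) + wt_{B∪C,w_B}(S ∩ (B∪C)).

data Region : Set where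
  inA inB inC : Region

isA isB isC : Region → Bool
isA inA = true
isA _   = false
isB inB = true
isB _   = false
isC inC = true
isC _   = false

InRegion : ∀ {n} → Subset n → Subset n → Subset n → Fin n → Region → Set
InRegion A B C u r = lookup A u ≡ isA r × lookup B u ≡ isB r × lookup C u ≡ isC r

regionOf : ∀ {n} {A B C : Subset n} → IsPartition A B C → ∀ u → ∃ (InRegion A B C u)
regionOf part u with part u
... | inj₁ u∈A        , A∌B , A∌C , _   = inA , ∈⇒lookup u∈A , ∉⇒lookup (A∌B u∈A) , ∉⇒lookup (A∌C u∈A)
... | inj₂ (inj₁ u∈B) , A∌B , _   , B∌C = inB , ∉⇒lookup (λ u∈A → A∌B u∈A u∈B) , ∈⇒lookup u∈B , ∉⇒lookup (B∌C u∈B)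
... | inj₂ (inj₂ u∈C) , _   , A∌C , B∌C = inC , ∉⇒lookup (λ u∈A → A∌C u∈A u∈C) , ∉⇒lookup (λ u∈B → B∌C u∈B u∈C) , ∈⇒lookup u∈C

Crossing BSided : Region → Region → Set
Crossing inA inB = Unit
Crossing inB inA = Unit
Crossing _   _   = ⊥
BSided inB inB = Unit
BSided inB inC = Unit
BSided inC inB = Unit
BSided _   _   = ⊥

glue-vertex : ∀ r σ {x y} → (r ≡ inB → y ≡ x) →
  chosenWt σ x + chosenWt (within (isC r) σ) y
  ≡ chosenWt (within (isA r ∨ isC r) σ) x + chosenWt (within (isB r ∨ isC r) σ) y
glue-vertex inA σ     _ = refl
glue-vertex inB σ {x} h rewrite h refl = +-identityʳ (chosenWt σ x)
glue-vertex inC σ     _ = refl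

glue-pair : ∀ r r' σ τ {a b c a' b' c' : ℕ} →
  (Crossing r r' → a ≡ 0 × b ≡ 0 × c ≡ 0) → (BSided r r' → a' ≡ a × b' ≡ b × c' ≡ c) →
  pairWt σ τ a b c + pairWt (within (isC r) σ) (within (isC r') τ) a' b' c'
  ≡ pairWt (within (isA r ∨ isC r) σ) (within (isA r' ∨ isC r') τ) a b c
    + pairWt (within (isB r ∨ isC r) σ) (within (isB r' ∨ isC r') τ) a' b' c'
glue-pair inA inA σ τ _ _ = refl
glue-pair inA inB σ τ h _ rewrite proj₁ (h tt) | proj₁ (proj₂ (h tt)) | proj₂ (proj₂ (h tt)) =
  trans (cong (_+ 0) (pairWt-zero σ τ)) (cong (_+ 0) (sym (pairWt-outsideʳ σ 0 0 0)))
glue-pair inA inC σ τ _ _ = refl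
glue-pair inB inA σ τ {a' = a'} {b'} {c'} h _ rewrite proj₁ (h tt) | proj₁ (proj₂ (h tt)) | proj₂ (proj₂ (h tt)) =
  trans (cong (_+ 0) (pairWt-zero σ τ)) (sym (pairWt-outsideʳ σ a' b' c'))
glue-pair inB inB σ τ {a} {b} {c} _ h rewrite proj₁ (h tt) | proj₁ (proj₂ (h tt)) | proj₂ (proj₂ (h tt)) =
  +-identityʳ (pairWt σ τ a b c)
glue-pair inB inC σ τ {a} {b} {c} _ h rewrite proj₁ (h tt) | proj₁ (proj₂ (h tt)) | proj₂ (proj₂ (h tt)) =
  +-identityʳ (pairWt σ τ a b c)
glue-pair inC inA σ τ _ _ = refl
glue-pair inC inB σ τ {a} {b} {c} _ h rewrite proj₁ (h tt) | proj₁ (proj₂ (h tt)) | proj₂ (proj₂ (h tt))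
  | pairWt-outsideʳ σ a b c = +-identityʳ (pairWt σ τ a b c)
glue-pair inC inC σ τ _ _ = refl

restrict-⊤ : ∀ {n} (X S : Subset n) u → σ[ X , S ∩ X ] u ≡ within (lookup X u) (σ[ ⊤ , S ] u)
restrict-⊤ X S u = σ-∩ ⊤ X S u (λ _ → lookup-replicate u true)

crossing-∈ : ∀ {n} {A B C : Subset n} {u v r r'} → InRegion A B C u r → InRegion A B C v r' →
  Crossing r r' → (u ∈ A × v ∈ B) ⊎ (u ∈ B × v ∈ A)
crossing-∈ {r = inA} {inB} (au , _ , _) (_ , bv , _) _ = inj₁ (lookup⇒∈ au , lookup⇒∈ bv)
crossing-∈ {r = inB} {inA} (_ , bu , _) (av , _ , _) _ = inj₂ (lookup⇒∈ bu , lookup⇒∈ av)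

b-sided-∈ : ∀ {n} {A B C : Subset n} {u v r r'} → InRegion A B C u r → InRegion A B C v r' →
  BSided r r' → u ∈ B ∪ C × v ∈ B ∪ C × (u ∉ C ⊎ v ∉ C)
b-sided-∈ {r = inB} {inB} (_ , bu , cu) (_ , bv , _) _ =
  x∈p∪q⁺ (inj₁ (lookup⇒∈ bu)) , x∈p∪q⁺ (inj₁ (lookup⇒∈ bv)) , inj₁ (lookup⇒∉ cu)
b-sided-∈ {r = inB} {inC} (_ , bu , cu) (_ , _ , cv) _ =
  x∈p∪q⁺ (inj₁ (lookup⇒∈ bu)) , x∈p∪q⁺ (inj₂ (lookup⇒∈ cv)) , inj₁ (lookup⇒∉ cu)
b-sided-∈ {r = inC} {inB} (_ , _ , cu) (_ , bv , cv) _ =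
  x∈p∪q⁺ (inj₂ (lookup⇒∈ cu)) , x∈p∪q⁺ (inj₁ (lookup⇒∈ bv)) , inj₂ (lookup⇒∉ cv)

glue : ∀ {n} (w wB : Weights n) (A B C S : Subset n) → IsPartition A B C →
  (∀ u v → (u ∈ A × v ∈ B) ⊎ (u ∈ B × v ∈ A) → wo w u v ≡ 0 × wo w v u ≡ 0 × wu w u v ≡ 0) →
  (∀ u → u ∈ B → wv wB u ≡ wv w u) →
  (∀ u v → u ∈ B ∪ C → v ∈ B ∪ C → u ≢ v → (u ∉ C ⊎ v ∉ C) →
     wo wB u v ≡ wo w u v × wo wB v u ≡ wo w v u × wu wB u v ≡ wu w u v) →
  wt ⊤ w S + wt C wB (S ∩ C) ≡ wt (A ∪ C) w (S ∩ (A ∪ C)) + wt (B ∪ C) wB (S ∩ (B ∪ C))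
glue {n} w wB A B C S part cut same-vertex same-pair = begin
  wt ⊤ w S + wt C wB (S ∩ C)
    ≡⟨ wt₂-local ⊤ w S C wB (S ∩ C) ⟩
  Σ[ n ] (λ u → vertexTerm w σ u + vertexTerm wB σ[ C , S ∩ C ] u)
  + Σ< (λ u v → pairTerm w σ u v + pairTerm wB σ[ C , S ∩ C ] u v)
    ≡⟨ cong₂ _+_ (Σ-cong vertex) (Σ<-cong pair) ⟩
  Σ[ n ] (λ u → vertexTerm w σ[ A ∪ C , S ∩ (A ∪ C) ] u + vertexTerm wB σ[ B ∪ C , S ∩ (B ∪ C) ] u)
  + Σ< (λ u v → pairTerm w σ[ A ∪ C , S ∩ (A ∪ C) ] u v + pairTerm wB σ[ B ∪ C , S ∩ (B ∪ C) ] u v)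
    ≡⟨ sym (wt₂-local (A ∪ C) w (S ∩ (A ∪ C)) (B ∪ C) wB (S ∩ (B ∪ C))) ⟩
  wt (A ∪ C) w (S ∩ (A ∪ C)) + wt (B ∪ C) wB (S ∩ (B ∪ C)) ∎
  where
  open ≡-Reasoning
  σ = σ[ ⊤ , S ]
  vertex : ∀ u → vertexTerm w σ u + vertexTerm wB σ[ C , S ∩ C ] u
               ≡ vertexTerm w σ[ A ∪ C , S ∩ (A ∪ C) ] u + vertexTerm wB σ[ B ∪ C , S ∩ (B ∪ C) ] u
  vertex u with regionOf part u
  ... | r , (au , bu , cu)
    rewrite restrict-⊤ C S u | restrict-⊤ (A ∪ C) S u | restrict-⊤ (B ∪ C) S u
          | lookup-zipWith _∨_ u A C | lookup-zipWith _∨_ u B C | au | bu | cu =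
    glue-vertex r (σ u) (λ { refl → same-vertex u (lookup⇒∈ bu) })
  pair : ∀ u v → u F.< v →
    pairTerm w σ u v + pairTerm wB σ[ C , S ∩ C ] u v
    ≡ pairTerm w σ[ A ∪ C , S ∩ (A ∪ C) ] u v + pairTerm wB σ[ B ∪ C , S ∩ (B ∪ C) ] u v
  pair u v u<v with regionOf part u | regionOf part v
  ... | r , reg@(au , bu , cu) | r' , reg'@(av , bv , cv)
    rewrite restrict-⊤ C S u | restrict-⊤ (A ∪ C) S u | restrict-⊤ (B ∪ C) S u
          | restrict-⊤ C S v | restrict-⊤ (A ∪ C) S v | restrict-⊤ (B ∪ C) S v
          | lookup-zipWith _∨_ u A C | lookup-zipWith _∨_ u B C
          | lookup-zipWith _∨_ v A C | lookup-zipWith _∨_ v B C | au | bu | cu | av | bv | cv =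
    glue-pair r r' (σ u) (σ v)
      (λ x → cut u v (crossing-∈ {A = A} {B} {C} reg reg' x))
      (λ x → let (u∈BC , v∈BC , notC) = b-sided-∈ {A = A} {B} {C} reg reg' x in
             same-pair u v u∈BC v∈BC (FinP.<⇒≢ u<v) notC)

-- Relaxing strongly anti-adjacent pairs to semi-adjacent ones does not
-- change which pairs are anti-adjacent, hence not the stable sets.

anti-Anti : Anti anti
anti-Anti ()

semi-Anti : Anti semi
semi-Anti ()

relax-anti : ∀ {n} {G H : Trigraph n} {X : Subset n} → Relaxes G X H → ∀ {u v} → u ∈ X → v ∈ X → u ≢ v →
  (Anti (θ G u v) → Anti (θ H u v)) × (Anti (θ H u v) → Anti (θ G u v))
relax-anti rel {u} {v} u∈X v∈X u≢v with rel u v u∈X v∈X u≢v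
... | inj₁ same         = (λ g h → g (trans (sym same) h)) , (λ h g → h (trans same g))
... | inj₂ (g-anti , h-semi) = (λ _ → subst Anti (sym h-semi) semi-Anti) , (λ _ → subst Anti (sym g-anti) anti-Anti)

stable-relax : ∀ {n} {G H : Trigraph n} {X S : Subset n} → Relaxes G X H → S ⊆ X → Stable G S → Stable H S
stable-relax {G = G} {H} rel S⊆X st u v u∈S v∈S u≢v = proj₁ (relax-anti {G = G} {H} rel (S⊆X u∈S) (S⊆X v∈S) u≢v) (st u v u∈S v∈S u≢v)

stable-unrelax : ∀ {n} {G H : Trigraph n} {X S : Subset n} → Relaxes G X H → S ⊆ X → Stable H S → Stable G S
stable-unrelax {G = G} {H} rel S⊆X st u v u∈S v∈S u≢v = proj₂ (relax-anti {G = G} {H} rel (S⊆X u∈S) (S⊆X v∈S) u≢v) (st u v u∈S v∈S u≢v)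

A-apart : ∀ {n} {A B C : Subset n} → IsPartition A B C → ∀ {u} → u ∈ A → u ∉ B ∪ C
A-apart {B = B} {C} part {u} u∈A u∈BC with x∈p∪q⁻ B C u∈BC
... | inj₁ u∈B = proj₁ (proj₂ (part u)) u∈A u∈B
... | inj₂ u∈C = proj₁ (proj₂ (proj₂ (part u))) u∈A u∈C

B-apart : ∀ {n} {A B C : Subset n} → IsPartition A B C → ∀ {u} → u ∈ B → u ∉ A ∪ C
B-apart {A = A} {C = C} part {u} u∈B u∈AC with x∈p∪q⁻ A C u∈AC
... | inj₁ u∈A = proj₁ (proj₂ (part u)) u∈A u∈B
... | inj₂ u∈C = proj₂ (proj₂ (proj₂ (part u))) u∈B u∈C

module Glued {n} {A B C : Subset n} (part : IsPartition A B C)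
             {P T : Subset n} (P⊆A∪T∩C : P ⊆ A ∪ (T ∩ C)) (T⊆B∪C : T ⊆ B ∪ C) where

  S : Subset n
  S = P ∪ (T ∩ B)

  P⊆A∪C : P ⊆ A ∪ C
  P⊆A∪C u∈P with x∈p∪q⁻ A (T ∩ C) (P⊆A∪T∩C u∈P)
  ... | inj₁ u∈A  = x∈p∪q⁺ (inj₁ u∈A)
  ... | inj₂ u∈TC = x∈p∪q⁺ (inj₂ (proj₂ (x∈p∩q⁻ T C u∈TC)))

  A-side : S ∩ (A ∪ C) ≡ P
  A-side = ⊆-antisym to-P from-P
    where
    to-P : S ∩ (A ∪ C) ⊆ P
    to-P u∈ with x∈p∩q⁻ S (A ∪ C) u∈
    ... | u∈S , u∈AC with x∈p∪q⁻ P (T ∩ B) u∈S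
    ... | inj₁ u∈P  = u∈P
    ... | inj₂ u∈TB = ⊥-elim (B-apart part (proj₂ (x∈p∩q⁻ T B u∈TB)) u∈AC)
    from-P : P ⊆ S ∩ (A ∪ C)
    from-P u∈P = x∈p∩q⁺ (x∈p∪q⁺ (inj₁ u∈P) , P⊆A∪C u∈P)

  B-side⊆T : S ∩ (B ∪ C) ⊆ T
  B-side⊆T u∈ with x∈p∩q⁻ S (B ∪ C) u∈
  ... | u∈S , u∈BC with x∈p∪q⁻ P (T ∩ B) u∈S
  ... | inj₂ u∈TB = proj₁ (x∈p∩q⁻ T B u∈TB)
  ... | inj₁ u∈P with x∈p∪q⁻ A (T ∩ C) (P⊆A∪T∩C u∈P)
  ...   | inj₁ u∈A  = ⊥-elim (A-apart part u∈A u∈BC)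
  ...   | inj₂ u∈TC = proj₁ (x∈p∩q⁻ T C u∈TC)

  T∖B-side⊆C : ∀ u → u ∈ T → u ∉ S ∩ (B ∪ C) → u ∈ C
  T∖B-side⊆C u u∈T u∉ with x∈p∪q⁻ B C (T⊆B∪C u∈T)
  ... | inj₁ u∈B = ⊥-elim (u∉ (x∈p∩q⁺ (x∈p∪q⁺ (inj₂ (x∈p∩q⁺ (u∈T , u∈B))) , T⊆B∪C u∈T)))
  ... | inj₂ u∈C = u∈C

  module _ {G : Trigraph n} (cut : ∀ a b → a ∈ A → b ∈ B → θ G a b ≡ anti)
           (stP : Stable G P) (stT : Stable G T) where

    across : ∀ {x y} → x ∈ P → y ∈ T ∩ B → x ≢ y → Anti (θ G x y)
    across {x} {y} x∈P y∈TB x≢y with x∈p∪q⁻ A (T ∩ C) (P⊆A∪T∩C x∈P)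
    ... | inj₁ x∈A  = subst Anti (sym (cut x y x∈A (proj₂ (x∈p∩q⁻ T B y∈TB)))) anti-Anti
    ... | inj₂ x∈TC = stT x y (proj₁ (x∈p∩q⁻ T C x∈TC)) (proj₁ (x∈p∩q⁻ T B y∈TB)) x≢y

    stable : Stable G S
    stable u v u∈S v∈S u≢v with x∈p∪q⁻ P (T ∩ B) u∈S | x∈p∪q⁻ P (T ∩ B) v∈S
    ... | inj₁ u∈P  | inj₁ v∈P  = stP u v u∈P v∈P u≢v
    ... | inj₁ u∈P  | inj₂ v∈TB = across u∈P v∈TB u≢v
    ... | inj₂ u∈TB | inj₁ v∈P  = λ e → across v∈P u∈TB (λ e' → u≢v (sym e')) (trans (θ-sym G v u) e)
    ... | inj₂ u∈TB | inj₂ v∈TB = stT u v (proj₁ (x∈p∩q⁻ T B u∈TB)) (proj₁ (x∈p∩q⁻ T B v∈TB)) u≢v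

∩-∪-split : ∀ {n} (S A C : Subset n) → S ∩ (A ∪ C) ⊆ A ∪ (S ∩ C)
∩-∪-split S A C u∈ with x∈p∩q⁻ S (A ∪ C) u∈
... | u∈S , u∈AC with x∈p∪q⁻ A C u∈AC
... | inj₁ u∈A = x∈p∪q⁺ (inj₁ u∈A)
... | inj₂ u∈C = x∈p∪q⁺ (inj₂ (x∈p∩q⁺ (u∈S , u∈C)))

∪-∩-⊆ : ∀ {n} (A S C : Subset n) → A ∪ (S ∩ C) ⊆ A ∪ C
∪-∩-⊆ A S C u∈ with x∈p∪q⁻ A (S ∩ C) u∈
... | inj₁ u∈A  = x∈p∪q⁺ (inj₁ u∈A)
... | inj₂ u∈SC = x∈p∪q⁺ (inj₂ (p∩q⊆q S C u∈SC))

∩-∪-∩ : ∀ {n} (S B C : Subset n) → (S ∩ (B ∪ C)) ∩ C ≡ S ∩ C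
∩-∪-∩ S B C = begin
  (S ∩ (B ∪ C)) ∩ C   ≡⟨ ∩-assoc S (B ∪ C) C ⟩
  S ∩ ((B ∪ C) ∩ C)   ≡⟨ cong (S ∩_) (∩-comm (B ∪ C) C) ⟩
  S ∩ (C ∩ (B ∪ C))   ≡⟨ cong (λ X → S ∩ (C ∩ X)) (∪-comm B C) ⟩
  S ∩ (C ∩ (C ∪ B))   ≡⟨ cong (S ∩_) (∩-abs-∪ C B) ⟩
  S ∩ C               ∎
  where open ≡-Reasoning

module CutDecomposition {n} (G : Trigraph n) (w : Weights n) (A B C : Subset n)
  (isw : IsWeight G ⊤ w) (cut : IsCutPartition G A B C)
  (GA GB : Trigraph n) (relA : Relaxes G (A ∪ C) GA) (relB : Relaxes G (B ∪ C) GB)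
  (k : ℕ) (wB : Weights n) (iswB : IsWeight GB (B ∪ C) wB)
  (same-vertex : ∀ u → u ∈ B → wv wB u ≡ wv w u)
  (same-pair : ∀ u v → u ∈ B ∪ C → v ∈ B ∪ C → u ≢ v → (u ∉ C ⊎ v ∉ C) →
     wo wB u v ≡ wo w u v × wo wB v u ≡ wo w v u × wu wB u v ≡ wu w u v)
  (side-value : ∀ SC → SC ⊆ C → Stable GB SC →
     wt C wB SC + k ≡ αRed GA (A ∪ C) w (A ∪ SC) + Ext (A ∪ C) w (A ∪ SC)) where

  part : IsPartition A B C
  part = proj₁ cut

  anticomplete : ∀ a b → a ∈ A → b ∈ B → θ G a b ≡ anti
  anticomplete = proj₂ (proj₂ (proj₂ cut))

  β : Subset n → ℕ
  β R = αRed GA (A ∪ C) w R + Ext (A ∪ C) w R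

  dom : Dominated (A ∪ C) w
  dom u v _ _ = weight⇒dominated {G = G} {⊤} {w} isw u v ∈⊤ ∈⊤

  domB : Dominated (B ∪ C) wB
  domB = weight⇒dominated {G = GB} {B ∪ C} {wB} iswB

  -- pairs across the cut are strongly anti-adjacent, so they carry no weight
  no-cross-weight : ∀ u v → (u ∈ A × v ∈ B) ⊎ (u ∈ B × v ∈ A) →
    wo w u v ≡ 0 × wo w v u ≡ 0 × wu w u v ≡ 0
  no-cross-weight u v across =
    proj₁ (proj₂ (isw u v ∈⊤ ∈⊤ (distinct across))) (λ e → anti≢semi (trans (sym (θ-anti across)) e))
    where
    anti≢semi : anti ≢ semi
    anti≢semi ()
    θ-anti : (u ∈ A × v ∈ B) ⊎ (u ∈ B × v ∈ A) → θ G u v ≡ anti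
    θ-anti (inj₁ (u∈A , v∈B)) = anticomplete u v u∈A v∈B
    θ-anti (inj₂ (u∈B , v∈A)) = trans (θ-sym G u v) (anticomplete v u v∈A u∈B)
    distinct : (u ∈ A × v ∈ B) ⊎ (u ∈ B × v ∈ A) → u ≢ v
    distinct (inj₁ (u∈A , v∈B)) refl = proj₁ (proj₂ (part u)) u∈A v∈B
    distinct (inj₂ (u∈B , v∈A)) refl = proj₁ (proj₂ (part u)) v∈A u∈B

  glue-cut : ∀ S → wt ⊤ w S + wt C wB (S ∩ C) ≡ wt (A ∪ C) w (S ∩ (A ∪ C)) + wt (B ∪ C) wB (S ∩ (B ∪ C))
  glue-cut S = glue w wB A B C S part no-cross-weight same-vertex same-pair

  upper : α G ⊤ w ≤ k + α GB (B ∪ C) wB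
  upper = +-cancelˡ-≤ (wt C wB X) _ _ (begin
    wt C wB X + α G ⊤ w
      ≤⟨ +-monoʳ-≤ (wt C wB X) S-optimal ⟩
    wt C wB X + wt ⊤ w S
      ≡⟨ +-comm (wt C wB X) (wt ⊤ w S) ⟩
    wt ⊤ w S + wt C wB X
      ≡⟨ glue-cut S ⟩
    wt (A ∪ C) w (S ∩ (A ∪ C)) + wt (B ∪ C) wB (S ∩ (B ∪ C))
      ≤⟨ +-mono-≤ (β-upper GA (A ∪ C) (A ∪ X) w (∩-∪-split S A C) (∪-∩-⊆ A S C) dom (restricted {H = GA} relA))
                  (α-≥ GB (B ∪ C) wB (S ∩ (B ∪ C)) (p∩q⊆q S (B ∪ C)) (restricted {H = GB} relB)) ⟩
    β (A ∪ X) + α GB (B ∪ C) wB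
      ≡⟨ cong (_+ α GB (B ∪ C) wB) (sym (side-value X (p∩q⊆q S C) X-stable)) ⟩
    (wt C wB X + k) + α GB (B ∪ C) wB
      ≡⟨ +-assoc (wt C wB X) k (α GB (B ∪ C) wB) ⟩
    wt C wB X + (k + α GB (B ∪ C) wB) ∎)
    where
    open ≤-Reasoning
    optimal = α-attained G ⊤ w
    S = proj₁ optimal
    S-stable = proj₁ (proj₂ (proj₂ optimal))
    S-optimal = proj₂ (proj₂ (proj₂ optimal))
    X = S ∩ C
    restricted : ∀ {U H} → Relaxes G U H → Stable H (S ∩ U)
    restricted {U} {H} rel = stable-relax {G = G} {H} rel (p∩q⊆q S U) (stable-⊆ {H = G} (p∩q⊆p S U) S-stable)
    X-stable : Stable GB X
    X-stable = stable-relax {G = G} {GB} relB (λ u∈X → x∈p∪q⁺ (inj₂ (p∩q⊆q S C u∈X)))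
                 (stable-⊆ {H = G} (p∩q⊆p S C) S-stable)

  lower : k + α GB (B ∪ C) wB ≤ α G ⊤ w
  lower = +-cancelˡ-≤ (wt C wB X) _ _ (begin
    wt C wB X + (k + α GB (B ∪ C) wB)
      ≤⟨ +-monoʳ-≤ (wt C wB X) (+-monoʳ-≤ k T-optimal) ⟩
    wt C wB X + (k + wt (B ∪ C) wB T)
      ≡⟨ cong (λ Y → wt C wB Y + (k + wt (B ∪ C) wB T)) (sym (∩-∪-∩ S B C)) ⟩
    wt C wB (Z ∩ C) + (k + wt (B ∪ C) wB T)
      ≡⟨ rotate (wt C wB (Z ∩ C)) k (wt (B ∪ C) wB T) ⟩
    k + (wt (B ∪ C) wB T + wt C wB (Z ∩ C))
      ≤⟨ +-monoʳ-≤ k (exchange (B ∪ C) C wB (q⊆p∪q B C) B-side⊆T T⊆B∪C T∖B-side⊆C domB) ⟩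
    k + (wt (B ∪ C) wB Z + wt C wB (T ∩ C))
      ≡⟨ rotate' k (wt (B ∪ C) wB Z) (wt C wB (T ∩ C)) ⟩
    (wt C wB (T ∩ C) + k) + wt (B ∪ C) wB Z
      ≡⟨ cong (_+ wt (B ∪ C) wB Z) (side-value (T ∩ C) (p∩q⊆q T C) (stable-⊆ {H = GB} (p∩q⊆p T C) T-stable)) ⟩
    β (A ∪ (T ∩ C)) + wt (B ∪ C) wB Z
      ≤⟨ +-monoˡ-≤ (wt (B ∪ C) wB Z) P-optimal ⟩
    wt (A ∪ C) w P + wt (B ∪ C) wB Z
      ≡⟨ cong (λ Y → wt (A ∪ C) w Y + wt (B ∪ C) wB Z) (sym A-side) ⟩
    wt (A ∪ C) w (S ∩ (A ∪ C)) + wt (B ∪ C) wB Z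
      ≡⟨ sym (glue-cut S) ⟩
    wt ⊤ w S + wt C wB X
      ≤⟨ +-monoˡ-≤ (wt C wB X) (α-≥ G ⊤ w S (λ _ → ∈⊤) S-stable) ⟩
    α G ⊤ w + wt C wB X
      ≡⟨ +-comm (α G ⊤ w) (wt C wB X) ⟩
    wt C wB X + α G ⊤ w ∎)
    where
    open ≤-Reasoning
    rotate : ∀ x k t → x + (k + t) ≡ k + (t + x)
    rotate = solve-∀
    rotate' : ∀ k z s → k + (z + s) ≡ (s + k) + z
    rotate' = solve-∀
    optimalT = α-attained GB (B ∪ C) wB
    T = proj₁ optimalT
    T⊆B∪C = proj₁ (proj₂ optimalT)
    T-stable = proj₁ (proj₂ (proj₂ optimalT))
    T-optimal = proj₂ (proj₂ (proj₂ optimalT))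
    completion = β-attained GA (A ∪ C) (A ∪ (T ∩ C)) w (∪-∩-⊆ A T C) dom
    P = proj₁ completion
    P-stable = proj₁ (proj₂ (proj₂ completion))
    P-optimal = proj₂ (proj₂ (proj₂ completion))
    open Glued part {P} {T} (proj₁ (proj₂ completion)) T⊆B∪C
    Z = S ∩ (B ∪ C)
    X = S ∩ C
    S-stable : Stable G S
    S-stable = stable {G = G} anticomplete (stable-unrelax {G = G} {GA} relA P⊆A∪C P-stable)
                                   (stable-unrelax {G = G} {GB} relB T⊆B∪C T-stable)

proposition3p9 : ∀ {n} (G : Trigraph n) (w : Weights n) (A B C : Subset n)
  → IsWeight G ⊤ w
  → IsCutPartition G A B C
  → (GA GB : Trigraph n)
  → Relaxes G (A ∪ C) GA
  → Relaxes G (B ∪ C) GB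
  → (k : ℕ) (wB : Weights n)
  → IsWeight GB (B ∪ C) wB
  → (∀ u → u ∈ B → wv wB u ≡ wv w u)
  → (∀ u v → u ∈ B ∪ C → v ∈ B ∪ C → u ≢ v → (u ∉ C ⊎ v ∉ C) →
       wo wB u v ≡ wo w u v × wo wB v u ≡ wo w v u × wu wB u v ≡ wu w u v)
  → (∀ SC → SC ⊆ C → Stable GB SC →
       wt C wB SC + k ≡ αRed GA (A ∪ C) w (A ∪ SC) + Ext (A ∪ C) w (A ∪ SC))
  → α G ⊤ w ≡ k + α GB (B ∪ C) wB
proposition3p9 G w A B C isw cut GA GB relA relB k wB iswB same-vertex same-pair side-value =
  ≤-antisym upper lower
  where
  open CutDecomposition G w A B C isw cut GA GB relA relB k wB iswB same-vertex same-pair side-value
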